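{- Suppose a trihex has mirror symmetry but does not have 3-fold rotational symmetry. Then exactly one... more precisely: one of its three equivalent signatures is self-mirror, and the other two equivalent signatures are each other's mirror signatures.
   Context: A trihex is a 3-regular graph embedded in the plane (equivalently the sphere) whose faces all have 3 or 6 sides, considered up to orientation-preserving homeomorphism. It has mirror symmetry if it can be embedded on the sphere so that a reflection of the sphere induces a graph automorphism, and 3-fold rotational symmetry if it can be embedded on the sphere so that an order-3 rotation of the sphere induces a graph automorphism. Every trihex arises as the quotient of the regular hexagonal tiling of the plane (hexagons in vertical columns) by the group generated by $180^\circ$ rotations about the centers of a set of "special" hexagons whose centers form a parallelogram lattice. Columns containing special hexagons are spine columns, others belt columns. A signature $(s,b,f)$ consists of the spine length $s\ge0$ (number of hexagons strictly between consecutive special hexagons in a spine column), the number $b\ge0$ of belt columns between adjacent spine columns, and the offset $f\in[0,s]$ (translating a special hexagon $b+1$ columns in the SW-to-NE direction lands it $f$ hexagons below a special hexagon). The other two column directions ($60^\circ$, $120^\circ$ clockwise from north) give two further signatures; the three are the trihex's equivalent signatures. The mirror signature of $(s,b,f)$ is $(s,b,(s-b-f)\bmod(s+1))$ (residue in $[0,s]$), which is a signature of the mirror-image trihex; a signature is self-mirror if it is identical to its mirror signature. -}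

module Defs where

open import Data.Nat as ℕ using (ℕ; suc; _≤_)
open import Data.Integer using (ℤ; +_; _+_; _*_; -_; _-_)
open import Data.Integer.DivMod using (_%ℕ_)
open import Data.Product using (Σ; _×_; _,_)
open import Function.Bundles using (_⇔_)
open import Relation.Binary.PropositionalEquality using (_≡_)

-- Hexagon centres of the regular hexagonal tiling (hexagons in vertical
-- columns), in coordinates (a , c) meaning  a·N + c·NE , where N is the
-- step to the hexagon directly above and NE the step to the adjacent
-- hexagon in the next column in the SW-to-NE direction.  The column of
-- (a , c) is c.
Hex : Set
Hex = ℤ × ℤ

-- rotation of the tiling by 60° clockwise about the hexagon centre (0,0):
-- N ↦ NE, NE ↦ SE = NE - N
rot60 : Hex → Hex
rot60 (a , c) = (- c , a + c)

rotPow : ℕ → Hex → Hex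
rotPow ℕ.zero x = x
rotPow (suc k) x = rot60 (rotPow k x)

-- reflection of the tiling in the vertical line through (0,0):
-- N ↦ N, NE ↦ NW = N - NE
reflect : Hex → Hex
reflect (a , c) = (a + c , - c)

translate : Hex → Hex → Hex
translate (t , u) (a , c) = (t + a , u + c)

record Signature : Set where
  constructor sig
  field
    s : ℕ
    b : ℕ
    f : ℕ
open Signature public

ValidSig : Signature → Set
ValidSig σ = f σ ≤ s σ

mirrorSig : Signature → Signature
mirrorSig (sig s b f) = sig s b ((+ s - + b - + f) %ℕ suc s)

SelfMirror : Signature → Set
SelfMirror σ = mirrorSig σ ≡ σ

-- The set of special hexagons of the trihex with signature σ (normalised
-- so that (0,0) is special): the lattice spanned by (s+1)·N (spine
-- direction) and (b+1)·NE + f·N.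
Special : Signature → Hex → Set
Special (sig s b f) (a , c) =
  Σ ℤ λ m → Σ ℤ λ k → (a ≡ m * + suc s + k * + f) × (c ≡ k * + suc b)

-- a map of the tiling carries the special set onto itself (for the
-- bijective affine maps used below this is exactly normalising the group
-- generated by the 180° rotations about special hexagons)
PreservesSpecial : Signature → (Hex → Hex) → Set
PreservesSpecial σ g = ∀ x → Special σ x ⇔ Special σ (g x)

-- mirror symmetry: some orientation-reversing symmetry of the hexagonal
-- tiling  x ↦ R^j (reflect x) + t  preserves the special set, hence
-- induces a reflection of the quotient sphere
MirrorSymmetry : Signature → Set
MirrorSymmetry σ =
  Σ ℕ λ j → Σ Hex λ t → PreservesSpecial σ (λ x → translate t (rotPow j (reflect x)))

-- 3-fold rotational symmetry: some 120° rotation of the hexagonal tiling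
-- x ↦ R^2 x + t  preserves the special set, hence induces an order-3
-- rotation of the quotient sphere
ThreeFoldSymmetry : Signature → Set
ThreeFoldSymmetry σ =
  Σ Hex λ t → PreservesSpecial σ (λ x → translate t (rotPow 2 x))

-- τ is the signature of the trihex σ read in the column direction
-- 60·k degrees clockwise from north: rotating the configuration of τ by
-- 60·k° clockwise gives the special set of σ.
SigInDirection : Signature → ℕ → Signature → Set
SigInDirection σ k τ = ∀ x → Special τ x ⇔ Special σ (rotPow k x)

-- The special set of a signature (s , b , f) is the lattice spanned by (s+1)·N and
-- (b+1)·NE + f·N, and it determines a valid signature. A mirror symmetry
-- x ↦ R^j (reflect x) + t preserves this lattice only if its linear part does, and
-- as R³ = -1 preserves every lattice we may take j < 3. Since
-- R^(k+i) ∘ reflect ∘ R^i ∘ reflect = R^k, reflecting the lattice read in direction i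
-- gives the lattice read in direction k whenever i + k ≡ j (mod 3); and reflection
-- turns the offset f into -(b+1) - f, which is the mirror offset modulo s+1. The
-- three pairs (i , k) with i + k ≡ j consist of one pair i = k and two swapped ones.

module Submission where

open import Defs
open import Data.Product using (_×_; Σ; _,_)
open import Data.Sum using (_⊎_; inj₁; inj₂; [_,_]′)
open import Relation.Nullary using (¬_)
open import Relation.Binary.PropositionalEquality using (_≡_)

open import Data.Integer using (ℤ; +_; -[1+_]; 0ℤ; 1ℤ; _+_; _*_; -_; _-_; ∣_∣)
import Data.Integer.Properties as ℤ
open import Data.Integer.DivMod using (_%ℕ_; _/ℕ_; a≡a%ℕn+[a/ℕn]*n; n%ℕd<d)
open import Data.Integer.Tactic.RingSolver using (solve)
open import Data.List using ([]; _∷_)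
open import Data.Nat as ℕ using (ℕ; zero; suc; _<_; s≤s; s≤s⁻¹)
open import Data.Nat.DivMod using (_%_; [m+kn]%n≡m%n; m<n⇒m%n≡m)
open import Data.Nat.Divisibility using (_∣_; divides; ∣-antisym)
import Data.Nat.Properties as ℕ
open import Function using (_∘_)
open import Function.Bundles using (_⇔_; mk⇔; module Equivalence)
import Function.Properties.Equivalence as ⇔
open import Function.Related.Propositional using (module EquationalReasoning)
open import Relation.Binary.PropositionalEquality
  using (refl; sym; trans; cong; cong₂; subst; module ≡-Reasoning)

open Equivalence

rotPow-+ : ∀ m n x → rotPow (m ℕ.+ n) x ≡ rotPow m (rotPow n x)
rotPow-+ zero    n x = refl
rotPow-+ (suc m) n x = cong rot60 (rotPow-+ m n x)

rotPow-sucʳ : ∀ n x → rotPow (suc n) x ≡ rotPow n (rot60 x)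
rotPow-sucʳ zero    x = refl
rotPow-sucʳ (suc n) x = cong rot60 (rotPow-sucʳ n x)

rotPow-origin : ∀ n → rotPow n (0ℤ , 0ℤ) ≡ (0ℤ , 0ℤ)
rotPow-origin zero    = refl
rotPow-origin (suc n) = cong rot60 (rotPow-origin n)

rotPow-3 : ∀ a c → rotPow 3 (a , c) ≡ (- a , - c)
rotPow-3 a c = cong₂ _,_ first second
  where
  first : - (- c + (a + c)) ≡ - a
  first = solve (a ∷ c ∷ [])
  second : - (a + c) + (- c + (a + c)) ≡ - c
  second = solve (a ∷ c ∷ [])

reflect-involutive : ∀ x → reflect (reflect x) ≡ x
reflect-involutive (a , c) = cong₂ _,_ first (ℤ.neg-involutive c)
  where
  first : a + c + - c ≡ a
  first = solve (a ∷ c ∷ [])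

rot60-reflect-rot60 : ∀ x → rot60 (reflect (rot60 x)) ≡ reflect x
rot60-reflect-rot60 (a , c) = cong₂ _,_ (ℤ.neg-involutive (a + c)) second
  where
  second : - c + (a + c) + - (a + c) ≡ - c
  second = solve (a ∷ c ∷ [])

rotPow-reflect-rotPow : ∀ n x → rotPow n (reflect (rotPow n x)) ≡ reflect x
rotPow-reflect-rotPow zero    x = refl
rotPow-reflect-rotPow (suc n) x = begin
  rot60 (rotPow n (reflect (rotPow (suc n) x)))    ≡⟨ cong (rot60 ∘ rotPow n ∘ reflect) (rotPow-sucʳ n x) ⟩
  rot60 (rotPow n (reflect (rotPow n (rot60 x))))  ≡⟨ cong rot60 (rotPow-reflect-rotPow n (rot60 x)) ⟩
  rot60 (reflect (rot60 x))                        ≡⟨ rot60-reflect-rot60 x ⟩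
  reflect x                                        ∎
  where open ≡-Reasoning

rotPow-reflect-conjugate : ∀ k i x → rotPow (k ℕ.+ i) (reflect (rotPow i (reflect x))) ≡ rotPow k x
rotPow-reflect-conjugate k i x = begin
  rotPow (k ℕ.+ i) (reflect (rotPow i (reflect x)))    ≡⟨ rotPow-+ k i _ ⟩
  rotPow k (rotPow i (reflect (rotPow i (reflect x)))) ≡⟨ cong (rotPow k) (rotPow-reflect-rotPow i (reflect x)) ⟩
  rotPow k (reflect (reflect x))                       ≡⟨ cong (rotPow k) (reflect-involutive x) ⟩
  rotPow k x                                           ∎
  where open ≡-Reasoning

-- Special (sig s b f) is definitionally Lattice (+ suc s) (+ suc b) (+ f); integer
-- parameters allow the offset to be shifted and negated.
Lattice : ℤ → ℤ → ℤ → Hex → Set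
Lattice P B F (a , c) = Σ ℤ λ m → Σ ℤ λ k → (a ≡ m * P + k * F) × (c ≡ k * B)

module _ {P B F : ℤ} where

  lattice-origin : Lattice P B F (0ℤ , 0ℤ)
  lattice-origin = 0ℤ , 0ℤ , refl , refl

  lattice-translate : ∀ {x y} → Lattice P B F x → Lattice P B F y → Lattice P B F (translate x y)
  lattice-translate {_ , _} {_ , _} (m , k , refl , refl) (m′ , k′ , refl , refl) =
    m + m′ , k + k′ , first , second
    where
    first : m * P + k * F + (m′ * P + k′ * F) ≡ (m + m′) * P + (k + k′) * F
    first = solve (m ∷ k ∷ m′ ∷ k′ ∷ P ∷ F ∷ [])
    second : k * B + k′ * B ≡ (k + k′) * B
    second = solve (k ∷ k′ ∷ B ∷ [])

  lattice-negate : ∀ {a c} → Lattice P B F (a , c) → Lattice P B F (- a , - c)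
  lattice-negate (m , k , refl , refl) =
    - m , - k , first , ℤ.neg-distribˡ-* k B
    where
    first : - (m * P + k * F) ≡ - m * P + - k * F
    first = solve (m ∷ k ∷ P ∷ F ∷ [])

  lattice-negate⇔ : ∀ a c → Lattice P B F (- a , - c) ⇔ Lattice P B F (a , c)
  lattice-negate⇔ a c = mk⇔
    (subst (Lattice P B F) (cong₂ _,_ (ℤ.neg-involutive a) (ℤ.neg-involutive c)) ∘ lattice-negate)
    lattice-negate

  lattice-translate⇔ : ∀ {t} x → Lattice P B F t → Lattice P B F (translate t x) ⇔ Lattice P B F x
  lattice-translate⇔ {t₁ , t₂} (a , c) t∈L = mk⇔
    (subst (Lattice P B F) (cong₂ _,_ (cancel t₁ a) (cancel t₂ c)) ∘ lattice-translate (lattice-negate t∈L))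
    (lattice-translate t∈L)
    where
    cancel : ∀ u v → - u + (u + v) ≡ v
    cancel u v = solve (u ∷ v ∷ [])

  lattice-offset : ∀ {F′} q → F′ ≡ F + q * P → ∀ x → Lattice P B F x ⇔ Lattice P B F′ x
  lattice-offset q refl (_ , _) = mk⇔
    (λ { (m , k , refl , refl) → m - k * q , k , shift m k , refl })
    (λ { (m , k , refl , refl) → m + k * q , k , unshift m k , refl })
    where
    shift : ∀ m k → m * P + k * F ≡ (m - k * q) * P + k * (F + q * P)
    shift m k = solve (m ∷ k ∷ q ∷ P ∷ F ∷ [])
    unshift : ∀ m k → m * P + k * (F + q * P) ≡ (m + k * q) * P + k * F
    unshift m k = solve (m ∷ k ∷ q ∷ P ∷ F ∷ [])

  lattice-reflect : ∀ {x} → Lattice P B F x → Lattice P B (- B - F) (reflect x)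
  lattice-reflect {_ , _} (m , k , refl , refl) = m , - k , first , ℤ.neg-distribˡ-* k B
    where
    first : m * P + k * F + k * B ≡ m * P + - k * (- B - F)
    first = solve (m ∷ k ∷ P ∷ B ∷ F ∷ [])

lattice-reflect⇔ : ∀ {P B F} x → Lattice P B F (reflect x) ⇔ Lattice P B (- B - F) x
lattice-reflect⇔ {P} {B} {F} x = mk⇔
  (subst (Lattice P B (- B - F)) (reflect-involutive x) ∘ lattice-reflect)
  (subst (λ G → Lattice P B G (reflect x)) (double-reflect-offset B F) ∘ lattice-reflect)
  where
  double-reflect-offset : ∀ B F → - B - (- B - F) ≡ F
  double-reflect-offset B F = solve (B ∷ F ∷ [])

mirror-offset : ∀ S B F R q → S - B - F ≡ R + q * (1ℤ + S) → - (1ℤ + B) - F ≡ R + (q - 1ℤ) * (1ℤ + S)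
mirror-offset S B F R q eq = begin
  - (1ℤ + B) - F               ≡⟨ solve (S ∷ B ∷ F ∷ []) ⟩
  (S - B - F) - (1ℤ + S)       ≡⟨ cong (_- (1ℤ + S)) eq ⟩
  R + q * (1ℤ + S) - (1ℤ + S)  ≡⟨ solve (S ∷ R ∷ q ∷ []) ⟩
  R + (q - 1ℤ) * (1ℤ + S)      ∎
  where open ≡-Reasoning

special-mirrorSig : ∀ σ x → Special (mirrorSig σ) x ⇔ Special σ (reflect x)
special-mirrorSig (sig s b f) x = begin
  Lattice P B (+ r) x       ∼⟨ lattice-offset (q - 1ℤ) offset x ⟩
  Lattice P B (- B - F) x   ∼⟨ ⇔.sym (lattice-reflect⇔ x) ⟩
  Lattice P B F (reflect x) ∎
  where
  open EquationalReasoning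
  P = + suc s
  B = + suc b
  F = + f
  r = (+ s - + b - F) %ℕ suc s
  q = (+ s - + b - F) /ℕ suc s
  offset : - B - F ≡ + r + (q - 1ℤ) * P
  offset = mirror-offset (+ s) (+ b) F (+ r) q (a≡a%ℕn+[a/ℕn]*n (+ s - + b - F) (suc s))

mirrorSig-valid : ∀ σ → ValidSig (mirrorSig σ)
mirrorSig-valid (sig s b f) = s≤s⁻¹ (n%ℕd<d (+ s - + b - + f) (suc s))

residue-unique : ∀ {n f f′} .{{_ : ℕ.NonZero n}} m → f < n → f′ < n → + f ≡ m * + n + + f′ → f ≡ f′
residue-unique {n} {f} {f′} (+ q) f<n f′<n eq = begin
  f                    ≡⟨ m<n⇒m%n≡m f<n ⟨
  f % n                ≡⟨ cong (_% n) (ℤ.+-injective eq′) ⟩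
  (q ℕ.* n ℕ.+ f′) % n ≡⟨ cong (_% n) (ℕ.+-comm (q ℕ.* n) f′) ⟩
  (f′ ℕ.+ q ℕ.* n) % n ≡⟨ [m+kn]%n≡m%n f′ q n ⟩
  f′ % n               ≡⟨ m<n⇒m%n≡m f′<n ⟩
  f′                   ∎
  where
  open ≡-Reasoning
  eq′ : + f ≡ + (q ℕ.* n ℕ.+ f′)
  eq′ = trans eq (cong (_+ + f′) (sym (ℤ.pos-* q n)))
residue-unique {n} {f} {f′} -[1+ q ] f<n f′<n eq =
  sym (residue-unique (+ suc q) f′<n f<n (move (+ f) -[1+ q ] (+ n) (+ f′) eq))
  where
  move : ∀ X M N Y → X ≡ M * N + Y → Y ≡ - M * N + X
  move _ M N Y refl = solve (M ∷ N ∷ Y ∷ [])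

special-spine : ∀ s b f → Special (sig s b f) (+ suc s , 0ℤ)
special-spine s b f = 1ℤ , 0ℤ , sym (trans (ℤ.+-identityʳ _) (ℤ.*-identityˡ _)) , refl

special-belt : ∀ s b f → Special (sig s b f) (+ f , + suc b)
special-belt s b f = 0ℤ , 1ℤ , sym (trans (ℤ.+-identityˡ _) (ℤ.*-identityˡ _)) , sym (ℤ.*-identityˡ _)

spine-divides : ∀ {s b f n} → Special (sig s b f) (+ n , 0ℤ) → suc s ∣ n
spine-divides {s} (m , k , eq , 0≡kB) with ℤ.i*j≡0⇒i≡0∨j≡0 k (sym 0≡kB)
... | inj₁ refl =
  divides ∣ m ∣ (trans (cong ∣_∣ (trans eq (ℤ.+-identityʳ (m * + suc s)))) (ℤ.abs-* m (+ suc s)))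

belt-divides : ∀ {s b f a n} → Special (sig s b f) (a , + n) → suc b ∣ n
belt-divides {b = b} (m , k , _ , eq) = divides ∣ k ∣ (trans (cong ∣_∣ eq) (ℤ.abs-* k (+ suc b)))

offset-unique : ∀ {s b f f′} → ValidSig (sig s b f) → ValidSig (sig s b f′) →
                Special (sig s b f′) (+ f , + suc b) → f ≡ f′
offset-unique {s} {b} {f} {f′} f≤s f′≤s (m , k , eq , B≡kB) =
  residue-unique m (s≤s f≤s) (s≤s f′≤s) (trans eq (cong (λ z → m * + suc s + z) kF≡F))
  where
  k≡1 : k ≡ 1ℤ
  k≡1 = ℤ.*-cancelʳ-≡ k 1ℤ (+ suc b) (trans (sym B≡kB) (sym (ℤ.*-identityˡ _)))
  kF≡F : k * + f′ ≡ + f′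
  kF≡F = trans (cong (_* + f′) k≡1) (ℤ.*-identityˡ _)

SameSpecial : Signature → Signature → Set
SameSpecial σ σ′ = ∀ x → Special σ x ⇔ Special σ′ x

special-injective : ∀ {σ σ′} → ValidSig σ → ValidSig σ′ → SameSpecial σ σ′ → σ ≡ σ′
special-injective {sig s b f} {sig s′ b′ f′} f≤s f′≤s′ same
  with ℕ.suc-injective (∣-antisym (spine-divides (from (same _) (special-spine s′ b′ f′)))
                                  (spine-divides (to (same _) (special-spine s b f))))
     | ℕ.suc-injective (∣-antisym (belt-divides (from (same _) (special-belt s′ b′ f′)))
                                  (belt-divides (to (same _) (special-belt s b f))))
... | refl | refl = cong (sig s b) (offset-unique f≤s f′≤s′ (to (same _) (special-belt s b f)))

special-rotPow-3 : ∀ σ x → Special σ (rotPow 3 x) ⇔ Special σ x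
special-rotPow-3 σ@(sig _ _ _) (a , c) =
  subst (λ y → Special σ y ⇔ Special σ (a , c)) (sym (rotPow-3 a c)) (lattice-negate⇔ a c)

preservesSpecial-linearPart : ∀ σ t g → g (0ℤ , 0ℤ) ≡ (0ℤ , 0ℤ) →
                              PreservesSpecial σ (translate t ∘ g) → PreservesSpecial σ g
preservesSpecial-linearPart σ@(sig _ _ _) t@(t₁ , t₂) g g0≡0 preserves x =
  ⇔.trans (preserves x) (lattice-translate⇔ (g x) t∈L)
  where
  t∈L : Special σ t
  t∈L = subst (Special σ) (cong₂ _,_ (ℤ.+-identityʳ t₁) (ℤ.+-identityʳ t₂))
          (subst (Special σ ∘ translate t) g0≡0 (to (preserves (0ℤ , 0ℤ)) lattice-origin))

MirrorInvariant : Signature → ℕ → Set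
MirrorInvariant σ j = PreservesSpecial σ (rotPow j ∘ reflect)

mirrorInvariant-+3 : ∀ {σ} j → MirrorInvariant σ j → MirrorInvariant σ (3 ℕ.+ j)
mirrorInvariant-+3 {σ} j inv x = ⇔.trans (inv x) (⇔.sym (special-rotPow-3 σ (rotPow j (reflect x))))

mirrorInvariant-+3⁻¹ : ∀ {σ} j → MirrorInvariant σ (3 ℕ.+ j) → MirrorInvariant σ j
mirrorInvariant-+3⁻¹ {σ} j inv x = ⇔.trans (inv x) (special-rotPow-3 σ (rotPow j (reflect x)))

mirrorInvariant-mod3 : ∀ {σ} j → MirrorInvariant σ j →
                       MirrorInvariant σ 0 ⊎ MirrorInvariant σ 1 ⊎ MirrorInvariant σ 2
mirrorInvariant-mod3 0                   inv = inj₁ inv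
mirrorInvariant-mod3 1                   inv = inj₂ (inj₁ inv)
mirrorInvariant-mod3 2                   inv = inj₂ (inj₂ inv)
mirrorInvariant-mod3 (suc (suc (suc j))) inv = mirrorInvariant-mod3 j (mirrorInvariant-+3⁻¹ j inv)

mirrorSymmetry⇒mirrorInvariant : ∀ {σ} → MirrorSymmetry σ →
                                 MirrorInvariant σ 0 ⊎ MirrorInvariant σ 1 ⊎ MirrorInvariant σ 2
mirrorSymmetry⇒mirrorInvariant {σ} (j , t , preserves) =
  mirrorInvariant-mod3 j (preservesSpecial-linearPart σ t (rotPow j ∘ reflect) (rotPow-origin j) preserves)

mirrorSig-sigInDirection : ∀ {σ τ τ′} i k → ValidSig τ → ValidSig τ′ →
                           SigInDirection σ i τ → SigInDirection σ k τ′ →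
                           MirrorInvariant σ (k ℕ.+ i) → mirrorSig τ ≡ τ′
mirrorSig-sigInDirection {σ} {τ} {τ′} i k valid valid′ dir dir′ inv =
  special-injective (mirrorSig-valid τ) valid′ same
  where
  open EquationalReasoning
  same : SameSpecial (mirrorSig τ) τ′
  same x = begin
    Special (mirrorSig τ) x                                       ∼⟨ special-mirrorSig τ x ⟩
    Special τ (reflect x)                                         ∼⟨ dir (reflect x) ⟩
    Special σ (rotPow i (reflect x))                              ∼⟨ inv (rotPow i (reflect x)) ⟩
    Special σ (rotPow (k ℕ.+ i) (reflect (rotPow i (reflect x)))) ≡⟨ cong (Special σ) (rotPow-reflect-conjugate k i x) ⟩
    Special σ (rotPow k x)                                        ∼⟨ ⇔.sym (dir′ x) ⟩
    Special τ′ x                                                  ∎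

sigInDirection-0 : ∀ σ → SigInDirection σ 0 σ
sigInDirection-0 σ x = ⇔.refl

lemma14 : (σ τ₁ τ₂ : Signature) → ValidSig σ → ValidSig τ₁ → ValidSig τ₂ →
    SigInDirection σ 1 τ₁ → SigInDirection σ 2 τ₂ →
    MirrorSymmetry σ → ¬ ThreeFoldSymmetry σ →
    (SelfMirror σ × mirrorSig τ₁ ≡ τ₂ × mirrorSig τ₂ ≡ τ₁)
    ⊎ (SelfMirror τ₁ × mirrorSig σ ≡ τ₂ × mirrorSig τ₂ ≡ σ)
    ⊎ (SelfMirror τ₂ × mirrorSig σ ≡ τ₁ × mirrorSig τ₁ ≡ σ)
-- Excluding 3-fold symmetry only matters for the uniqueness of the self-mirror
-- signature, which is not claimed here.
lemma14 σ τ₁ τ₂ v v₁ v₂ d₁ d₂ mirror _ =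
  [ inj₁ ∘ axis₀ , [ inj₂ ∘ inj₂ ∘ axis₁ , inj₂ ∘ inj₁ ∘ axis₂ ]′ ]′ (mirrorSymmetry⇒mirrorInvariant mirror)
  where
  d₀ : SigInDirection σ 0 σ
  d₀ = sigInDirection-0 σ
  axis₀ : MirrorInvariant σ 0 → SelfMirror σ × mirrorSig τ₁ ≡ τ₂ × mirrorSig τ₂ ≡ τ₁
  axis₀ inv = mirrorSig-sigInDirection 0 0 v v d₀ d₀ inv
            , mirrorSig-sigInDirection 1 2 v₁ v₂ d₁ d₂ (mirrorInvariant-+3 0 inv)
            , mirrorSig-sigInDirection 2 1 v₂ v₁ d₂ d₁ (mirrorInvariant-+3 0 inv)
  axis₁ : MirrorInvariant σ 1 → SelfMirror τ₂ × mirrorSig σ ≡ τ₁ × mirrorSig τ₁ ≡ σ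
  axis₁ inv = mirrorSig-sigInDirection 2 2 v₂ v₂ d₂ d₂ (mirrorInvariant-+3 1 inv)
            , mirrorSig-sigInDirection 0 1 v v₁ d₀ d₁ inv
            , mirrorSig-sigInDirection 1 0 v₁ v d₁ d₀ inv
  axis₂ : MirrorInvariant σ 2 → SelfMirror τ₁ × mirrorSig σ ≡ τ₂ × mirrorSig τ₂ ≡ σ
  axis₂ inv = mirrorSig-sigInDirection 1 1 v₁ v₁ d₁ d₁ inv
            , mirrorSig-sigInDirection 0 2 v v₂ d₀ d₂ inv
            , mirrorSig-sigInDirection 2 0 v₂ v d₂ d₀ inv
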